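{- For all integers $1\le k\le n$, the number of binary words of length $n+k-1$ with exactly $2k-1$ zeros equals the number of words of length $n-1$ over the alphabet $\{0,1,2\}$ having exactly $k-1$ letters equal to $2$ and not containing $01$ as a factor (no $0$ immediately followed by $1$). -}

module Defs where

open import Data.Nat using (ℕ; zero; suc)
open import Data.Fin using (Fin; zero; suc)
open import Data.Fin.Properties using (_≟_)
open import Data.Vec using (Vec; []; _∷_)
open import Data.List using (List; []; _∷_; map; concatMap; filter; length)
open import Data.Empty using (⊥)
open import Data.Product using (_×_)
open import Data.Sum using (_⊎_)
open import Relation.Nullary using (Dec; yes; no; ¬_)
open import Relation.Unary using (Pred; Decidable)
open import Relation.Binary.PropositionalEquality using (_≡_)
open import Level using (0ℓ)

allLetters : (a : ℕ) → List (Fin a)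
allLetters zero    = []
allLetters (suc a) = zero ∷ map suc (allLetters a)

allWords : (a m : ℕ) → List (Vec (Fin a) m)
allWords a zero    = [] ∷ []
allWords a (suc m) = concatMap (λ x → map (x ∷_) (allWords a m)) (allLetters a)

countWords : (a m : ℕ) (P : Pred (Vec (Fin a) m) 0ℓ) → Decidable P → ℕ
countWords a m P P? = length (filter P? (allWords a m))

occ : {a m : ℕ} → Fin a → Vec (Fin a) m → ℕ
occ c []      = 0
occ c (x ∷ w) with x ≟ c
... | yes _ = suc (occ c w)
... | no  _ = occ c w

Contains01 : {a m : ℕ} → Vec (Fin (suc (suc a))) m → Set
Contains01 []          = ⊥
Contains01 (x ∷ [])    = ⊥
Contains01 (x ∷ y ∷ w) = (x ≡ zero × y ≡ suc zero) ⊎ Contains01 (y ∷ w)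

contains01? : {a m : ℕ} (w : Vec (Fin (suc (suc a))) m) → Dec (Contains01 w)
contains01? []          = no (λ ())
contains01? (x ∷ [])    = no (λ ())
contains01? (x ∷ y ∷ w) with x ≟ zero | y ≟ suc zero | contains01? (y ∷ w)
... | yes p | yes q | _     = yes (_⊎_.inj₁ (p Data.Product., q))
... | _     | _     | yes r = yes (_⊎_.inj₂ r)
... | no ¬p | _     | no ¬r = no λ { (_⊎_.inj₁ (p Data.Product., _)) → ¬p p ; (_⊎_.inj₂ r) → ¬r r }
... | yes _ | no ¬q | no ¬r = no λ { (_⊎_.inj₁ (_ Data.Product., q)) → ¬q q ; (_⊎_.inj₂ r) → ¬r r }

BinWithZeros : (m z : ℕ) → Pred (Vec (Fin 2) m) 0ℓ
BinWithZeros m z w = occ zero w ≡ z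

binWithZeros? : (m z : ℕ) → Decidable (BinWithZeros m z)
binWithZeros? m z w = Data.Nat._≟_ (occ zero w) z
  where import Data.Nat

TernGood : (m t : ℕ) → Pred (Vec (Fin 3) m) 0ℓ
TernGood m t w = occ (suc (suc zero)) w ≡ t × ¬ Contains01 w

ternGood? : (m t : ℕ) → Decidable (TernGood m t)
ternGood? m t w with Data.Nat._≟_ (occ (suc (suc zero)) w) t | contains01? w
  where import Data.Nat
... | yes p | no ¬c = yes (p Data.Product., ¬c)
... | no ¬p | _     = no λ { (p Data.Product., _) → ¬p p }
... | yes _ | yes c = no λ { (_ Data.Product., ¬c) → ¬c c }

module Submission where

-- Both sides equal the binomial coefficient C(n+k-1, 2k-1). For binary words this is
-- the usual count by positions of zeros. For ternary words avoiding 01, split on the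
-- first letter: besides the good words g(m,j) of length m with j twos, one needs the
-- number a(m,j) of those that may follow a 0, i.e. do not start with 1. Then
--   g(m+1,j) = a(m,j) + g(m,j) + g(m,j-1)   and   a(m+1,j) = a(m,j) + g(m,j-1),
-- which are solved by g(m,j) = C(m+j+1, 2j+1) and a(m,j) = C(m+j, 2j) using Pascal's rule.

open import Defs
open import Data.Nat using (ℕ; zero; suc; _+_; _*_; _∸_; _≤_; s≤s; z≤n)
open import Data.Nat.Properties using (+-suc; *-suc; +-comm; +-identityʳ; suc-injective; m<m+n; +-commutativeSemigroup)
open import Algebra.Properties.CommutativeSemigroup +-commutativeSemigroup using (x∙yz≈zx∙y)
open import Data.Nat.Combinatorics using (_C_; k>n⇒nCk≡0)
  renaming (nCk+nC[k+1]≡[n+1]C[k+1] to pascal)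
open import Data.Nat.ListAction using (sum)
open import Data.Fin using (Fin; zero; suc)
open import Data.Vec using (Vec; _∷_)
open import Data.List using (List; []; _∷_; map; concatMap; filter; length; _++_)
open import Data.List.Properties using (length-++; filter-++; filter-≐; filter-none; map-cong)
import Data.List.Relation.Unary.All as All
open import Data.Product using (_,_; proj₁)
open import Data.Sum using (inj₁; inj₂)
open import Function using (_∘_)
open import Relation.Nullary using (¬_; yes; no; contradiction)
open import Relation.Unary using (Pred; Decidable; _≐_)
open import Relation.Unary.Properties using (≐-trans)
open import Relation.Binary.PropositionalEquality
  using (_≡_; _≢_; refl; sym; trans; cong; cong₂; module ≡-Reasoning)
open import Level using (Level)

open ≡-Reasoning

private
  variable
    a b p q : Level
    A : Set a
    B : Set b

count : {P : Pred A p} → Decidable P → List A → ℕ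
count P? xs = length (filter P? xs)

module _ {P : Pred A p} (P? : Decidable P) where

  count-++ : ∀ xs ys → count P? (xs ++ ys) ≡ count P? xs + count P? ys
  count-++ xs ys = trans (cong length (filter-++ P? xs ys)) (length-++ (filter P? xs))

  count-concatMap : (f : B → List A) (xs : List B) →
                    count P? (concatMap f xs) ≡ sum (map (count P? ∘ f) xs)
  count-concatMap f []       = refl
  count-concatMap f (x ∷ xs) =
    trans (count-++ (f x) (concatMap f xs)) (cong (count P? (f x) +_) (count-concatMap f xs))

  count-map : (f : B → A) (xs : List B) → count P? (map f xs) ≡ count (P? ∘ f) xs
  count-map f []       = refl
  count-map f (x ∷ xs) with P? (f x)
  ... | yes _ = cong suc (count-map f xs)
  ... | no  _ = count-map f xs

  count-none : (∀ x → ¬ P x) → ∀ xs → count P? xs ≡ 0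
  count-none ¬P xs = cong length (filter-none P? (All.universal ¬P xs))

count-≐ : {P : Pred A p} {Q : Pred A q} {P? : Decidable P} {Q? : Decidable Q} →
          P ≐ Q → ∀ xs → count P? xs ≡ count Q? xs
count-≐ {P? = P?} {Q? = Q?} P≐Q xs = cong length (filter-≐ P? Q? P≐Q xs)

count-allWords-suc : ∀ {s m} {P : Pred (Vec (Fin s) (suc m)) p} (P? : Decidable P) →
  count P? (allWords s (suc m)) ≡ sum (map (λ x → count (P? ∘ (x ∷_)) (allWords s m)) (allLetters s))
count-allWords-suc {s = s} {m} P? = begin
    count P? (concatMap (λ x → map (x ∷_) (allWords s m)) (allLetters s))
  ≡⟨ count-concatMap P? _ (allLetters s) ⟩
    sum (map (λ x → count P? (map (x ∷_) (allWords s m))) (allLetters s))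
  ≡⟨ cong sum (map-cong (λ x → count-map P? (x ∷_) (allWords s m)) (allLetters s)) ⟩
    sum (map (λ x → count (P? ∘ (x ∷_)) (allWords s m)) (allLetters s))
  ∎

binary : ℕ → ℕ → ℕ
binary m z = countWords 2 m (BinWithZeros m z) (binWithZeros? m z)

binary-suc-zero : ∀ m → binary (suc m) zero ≡ binary m zero
binary-suc-zero m = begin
    binary (suc m) zero
  ≡⟨ count-allWords-suc (binWithZeros? (suc m) zero) ⟩
    count (λ w → binWithZeros? (suc m) zero (zero ∷ w)) W + (binary m zero + 0)
  ≡⟨ cong₂ _+_ (count-none _ (λ _ ()) W) (+-identityʳ (binary m zero)) ⟩
    binary m zero
  ∎
  where W = allWords 2 m

binary-suc-suc : ∀ m z → binary (suc m) (suc z) ≡ binary m z + binary m (suc z)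
binary-suc-suc m z = begin
    binary (suc m) (suc z)
  ≡⟨ count-allWords-suc (binWithZeros? (suc m) (suc z)) ⟩
    count (λ w → binWithZeros? (suc m) (suc z) (zero ∷ w)) W + (binary m (suc z) + 0)
  ≡⟨ cong₂ _+_ (count-≐ (suc-injective , cong suc) W)
               (+-identityʳ (binary m (suc z))) ⟩
    binary m z + binary m (suc z)
  ∎
  where W = allWords 2 m

binary≡C : ∀ m z → binary m z ≡ m C z
binary≡C zero    zero    = refl
binary≡C zero    (suc z) = sym (k>n⇒nCk≡0 {0} {suc z} (s≤s z≤n))
binary≡C (suc m) zero    = trans (binary-suc-zero m) (binary≡C m zero)
binary≡C (suc m) (suc z) = begin
    binary (suc m) (suc z)
  ≡⟨ binary-suc-suc m z ⟩
    binary m z + binary m (suc z)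
  ≡⟨ cong₂ _+_ (binary≡C m z) (binary≡C m (suc z)) ⟩
    m C z + m C suc z
  ≡⟨ pascal m z ⟩
    suc m C suc z
  ∎

pattern one = suc zero
pattern two = suc (suc zero)

contains01-∷ : ∀ {s m} (x : Fin (suc (suc s))) (w : Vec _ m) → Contains01 w → Contains01 (x ∷ w)
contains01-∷ x (y ∷ w) c = inj₂ c

contains01-suc∷ : ∀ {s m} (x : Fin (suc s)) (w : Vec _ m) → Contains01 (suc x ∷ w) → Contains01 w
contains01-suc∷ x (y ∷ w) (inj₂ c) = c

contains01-zero∷ : ∀ {s m} {y : Fin (suc (suc s))} (w : Vec _ m) →
                   y ≢ one → Contains01 (zero ∷ y ∷ w) → Contains01 (y ∷ w)
contains01-zero∷ w y≢1 (inj₁ (_ , y≡1)) = contradiction y≡1 y≢1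
contains01-zero∷ w y≢1 (inj₂ c)         = c

module _ {m j : ℕ} where

  ternGood-one∷ : (λ w → TernGood (suc m) j (one ∷ w)) ≐ TernGood m j
  ternGood-one∷ = (λ {w} (o , ¬c) → o , ¬c ∘ contains01-∷ one w)
                , (λ {w} (o , ¬c) → o , ¬c ∘ contains01-suc∷ zero w)

  ternGood-two∷ : (λ w → TernGood (suc m) (suc j) (two ∷ w)) ≐ TernGood m j
  ternGood-two∷ = (λ {w} (o , ¬c) → suc-injective o , ¬c ∘ contains01-∷ two w)
                , (λ {w} (o , ¬c) → cong suc o , ¬c ∘ contains01-suc∷ one w)

  ternGood-zero∷ : {y : Fin 3} → y ≢ one →
                   (λ w → TernGood (suc (suc m)) j (zero ∷ y ∷ w)) ≐ (λ w → TernGood (suc m) j (y ∷ w))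
  ternGood-zero∷ {y} y≢1 = (λ {w} (o , ¬c) → o , ¬c ∘ contains01-∷ zero (y ∷ w))
                         , (λ {w} (o , ¬c) → o , ¬c ∘ contains01-zero∷ w y≢1)

  ¬ternGood-zero-one∷ : ∀ w → ¬ TernGood (suc (suc m)) j (zero ∷ one ∷ w)
  ¬ternGood-zero-one∷ w (_ , ¬c) = ¬c (inj₁ (refl , refl))

¬ternGood-two∷ : ∀ {m} w → ¬ TernGood (suc m) zero (two ∷ w)
¬ternGood-two∷ w (() , _)

good : ℕ → ℕ → ℕ
good m j = countWords 3 m (TernGood m j) (ternGood? m j)

goodAfterZero : ℕ → ℕ → ℕ
goodAfterZero m j = count (λ w → ternGood? (suc m) j (zero ∷ w)) (allWords 3 m)

good-suc-zero : ∀ m → good (suc m) zero ≡ goodAfterZero m zero + good m zero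
good-suc-zero m = begin
    good (suc m) zero
  ≡⟨ count-allWords-suc (ternGood? (suc m) zero) ⟩
    goodAfterZero m zero + (count (λ w → ternGood? (suc m) zero (one ∷ w)) W
                           + (count (λ w → ternGood? (suc m) zero (two ∷ w)) W + 0))
  ≡⟨ cong (goodAfterZero m zero +_)
          (cong₂ _+_ (count-≐ ternGood-one∷ W) (trans (+-identityʳ _) (count-none _ ¬ternGood-two∷ W))) ⟩
    goodAfterZero m zero + (good m zero + 0)
  ≡⟨ cong (goodAfterZero m zero +_) (+-identityʳ (good m zero)) ⟩
    goodAfterZero m zero + good m zero
  ∎
  where W = allWords 3 m

good-suc-suc : ∀ m j → good (suc m) (suc j) ≡ goodAfterZero m (suc j) + (good m (suc j) + good m j)
good-suc-suc m j = begin
    good (suc m) (suc j)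
  ≡⟨ count-allWords-suc (ternGood? (suc m) (suc j)) ⟩
    goodAfterZero m (suc j) + (count (λ w → ternGood? (suc m) (suc j) (one ∷ w)) W
                              + (count (λ w → ternGood? (suc m) (suc j) (two ∷ w)) W + 0))
  ≡⟨ cong (goodAfterZero m (suc j) +_)
          (cong₂ _+_ (count-≐ ternGood-one∷ W) (trans (+-identityʳ _) (count-≐ ternGood-two∷ W))) ⟩
    goodAfterZero m (suc j) + (good m (suc j) + good m j)
  ∎
  where W = allWords 3 m

goodAfterZero-suc-zero : ∀ m → goodAfterZero (suc m) zero ≡ goodAfterZero m zero
goodAfterZero-suc-zero m = begin
    goodAfterZero (suc m) zero
  ≡⟨ count-allWords-suc (λ w → ternGood? (suc (suc m)) zero (zero ∷ w)) ⟩
    count (λ w → ternGood? (suc (suc m)) zero (zero ∷ zero ∷ w)) W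
    + (count (λ w → ternGood? (suc (suc m)) zero (zero ∷ one ∷ w)) W
      + (count (λ w → ternGood? (suc (suc m)) zero (zero ∷ two ∷ w)) W + 0))
  ≡⟨ cong₂ _+_ (count-≐ (ternGood-zero∷ λ ()) W)
               (cong₂ _+_ (count-none _ ¬ternGood-zero-one∷ W)
                          (cong (_+ 0) (count-none _ (λ w → ¬ternGood-two∷ w ∘ proj₁ (ternGood-zero∷ λ ())) W))) ⟩
    goodAfterZero m zero + 0
  ≡⟨ +-identityʳ (goodAfterZero m zero) ⟩
    goodAfterZero m zero
  ∎
  where W = allWords 3 m

goodAfterZero-suc-suc : ∀ m j → goodAfterZero (suc m) (suc j) ≡ goodAfterZero m (suc j) + good m j
goodAfterZero-suc-suc m j = begin
    goodAfterZero (suc m) (suc j)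
  ≡⟨ count-allWords-suc (λ w → ternGood? (suc (suc m)) (suc j) (zero ∷ w)) ⟩
    count (λ w → ternGood? (suc (suc m)) (suc j) (zero ∷ zero ∷ w)) W
    + (count (λ w → ternGood? (suc (suc m)) (suc j) (zero ∷ one ∷ w)) W
      + (count (λ w → ternGood? (suc (suc m)) (suc j) (zero ∷ two ∷ w)) W + 0))
  ≡⟨ cong₂ _+_ (count-≐ (ternGood-zero∷ λ ()) W)
               (cong₂ _+_ (count-none _ ¬ternGood-zero-one∷ W)
                          (trans (+-identityʳ _) (count-≐ (≐-trans (ternGood-zero∷ λ ()) ternGood-two∷) W))) ⟩
    goodAfterZero m (suc j) + good m j
  ∎
  where W = allWords 3 m

pascal-twice : ∀ n k → n C suc k + (suc n C suc (suc k) + n C k) ≡ suc (suc n) C suc (suc k)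
pascal-twice n k = begin
    n C suc k + (suc n C suc (suc k) + n C k)
  ≡⟨ x∙yz≈zx∙y (n C suc k) (suc n C suc (suc k)) (n C k) ⟩
    (n C k + n C suc k) + suc n C suc (suc k)
  ≡⟨ cong (_+ suc n C suc (suc k)) (pascal n k) ⟩
    suc n C suc k + suc n C suc (suc k)
  ≡⟨ pascal (suc n) (suc k) ⟩
    suc (suc n) C suc (suc k)
  ∎

good≡C          : ∀ m j → good m j ≡ suc (m + j) C suc (2 * j)
goodAfterZero≡C : ∀ m j → goodAfterZero m j ≡ (m + j) C (2 * j)

good≡C zero    zero    = refl
good≡C zero    (suc j) = sym (k>n⇒nCk≡0 (s≤s (m<m+n (suc j) (s≤s z≤n))))
good≡C (suc m) zero    = begin
    good (suc m) zero
  ≡⟨ good-suc-zero m ⟩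
    goodAfterZero m zero + good m zero
  ≡⟨ cong₂ _+_ (goodAfterZero≡C m zero) (good≡C m zero) ⟩
    suc (m + 0) C 0 + suc (m + 0) C 1
  ≡⟨ pascal (suc (m + 0)) 0 ⟩
    suc (suc m + 0) C 1
  ∎
good≡C (suc m) (suc j) = begin
    good (suc m) (suc j)
  ≡⟨ good-suc-suc m j ⟩
    goodAfterZero m (suc j) + (good m (suc j) + good m j)
  ≡⟨ cong₂ _+_ (goodAfterZero≡C m (suc j)) (cong₂ _+_ (good≡C m (suc j)) (good≡C m j)) ⟩
    (m + suc j) C (2 * suc j) + (suc (m + suc j) C suc (2 * suc j) + suc (m + j) C suc (2 * j))
  ≡⟨ cong₂ (λ n k → n C k + (suc n C suc k + suc (m + j) C suc (2 * j))) (+-suc m j) (*-suc 2 j) ⟩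
    suc (m + j) C suc (suc (2 * j)) + (suc (suc (m + j)) C suc (suc (suc (2 * j))) + suc (m + j) C suc (2 * j))
  ≡⟨ pascal-twice (suc (m + j)) (suc (2 * j)) ⟩
    suc (suc (suc (m + j))) C suc (suc (suc (2 * j)))
  ≡⟨ cong₂ (λ n k → suc (suc n) C suc k) (+-suc m j) (*-suc 2 j) ⟨
    suc (suc m + suc j) C suc (2 * suc j)
  ∎

goodAfterZero≡C zero    zero    = refl
goodAfterZero≡C zero    (suc j) = sym (k>n⇒nCk≡0 (m<m+n (suc j) (s≤s z≤n)))
goodAfterZero≡C (suc m) zero    = trans (goodAfterZero-suc-zero m) (goodAfterZero≡C m zero)
goodAfterZero≡C (suc m) (suc j) = begin
    goodAfterZero (suc m) (suc j)
  ≡⟨ goodAfterZero-suc-suc m j ⟩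
    goodAfterZero m (suc j) + good m j
  ≡⟨ cong₂ _+_ (goodAfterZero≡C m (suc j)) (good≡C m j) ⟩
    (m + suc j) C (2 * suc j) + suc (m + j) C suc (2 * j)
  ≡⟨ cong₂ (λ n k → n C k + suc (m + j) C suc (2 * j)) (+-suc m j) (*-suc 2 j) ⟩
    suc (m + j) C suc (suc (2 * j)) + suc (m + j) C suc (2 * j)
  ≡⟨ +-comm (suc (m + j) C suc (suc (2 * j))) _ ⟩
    suc (m + j) C suc (2 * j) + suc (m + j) C suc (suc (2 * j))
  ≡⟨ pascal (suc (m + j)) (suc (2 * j)) ⟩
    suc (suc (m + j)) C suc (suc (2 * j))
  ≡⟨ cong₂ (λ n k → suc n C k) (+-suc m j) (*-suc 2 j) ⟨
    (suc m + suc j) C (2 * suc j)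
  ∎

mainTheorem16 : (n k : ℕ) → 1 ≤ k → k ≤ n →
    countWords 2 (n + k ∸ 1) (BinWithZeros (n + k ∸ 1) (2 * k ∸ 1)) (binWithZeros? (n + k ∸ 1) (2 * k ∸ 1))
      ≡ countWords 3 (n ∸ 1) (TernGood (n ∸ 1) (k ∸ 1)) (ternGood? (n ∸ 1) (k ∸ 1))
mainTheorem16 (suc m) (suc j) _ _ = begin
    binary (m + suc j) (2 * suc j ∸ 1)
  ≡⟨ binary≡C (m + suc j) (2 * suc j ∸ 1) ⟩
    (m + suc j) C (2 * suc j ∸ 1)
  ≡⟨ cong₂ _C_ (+-suc m j) (cong (_∸ 1) (*-suc 2 j)) ⟩
    suc (m + j) C suc (2 * j)
  ≡⟨ good≡C m j ⟨
    good m j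
  ∎
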